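{- Let $p$ be the partially ordered pattern of length $4$ on the labels $\{1,2,3,4\}$ whose only relations are $1>2$ and $1>4$ (label $3$ is incomparable to all others, and $2,4$ are incomparable). Let $a(n)$ be the number of $n$-permutations avoiding $p$. Then $$\sum_{n\geq 0}a(n)x^n=\frac{(1-x)^2}{1-3x+2x^2-2x^3}.$$
   Context: An $n$-permutation is a permutation $\pi=\pi_1\cdots\pi_n$ of $\{1,\dots,n\}$ written in one-line notation (for $n=0$ there is exactly one, the empty permutation). A partially ordered pattern (POP) $p$ of length $k$ is a partial order $<_P$ on the label set $\{1,\dots,k\}$. An occurrence of $p$ in $\pi$ is a subsequence $\pi_{i_1}\pi_{i_2}\cdots\pi_{i_k}$ with $1\leq i_1<\cdots<i_k\leq n$ such that $\pi_{i_j}<\pi_{i_m}$ whenever $j<_P m$ (no condition is imposed on pairs of incomparable labels). A permutation avoids $p$ if it contains no occurrence of $p$. -}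

module Defs where

open import Data.Nat as ℕ using (ℕ; zero; suc)
open import Data.Fin as Fin using (Fin; zero; suc)
open import Data.Fin.Properties using (any?; all?; _≟_)
import Data.Fin.Properties as FinP
open import Data.Vec using (Vec; []; _∷_; lookup)
open import Data.Integer as ℤ using (ℤ; +_; -[1+_])
open import Data.List using (List; []; _∷_)
open import Data.Product using (∃; _×_; _,_)
open import Relation.Nullary using (¬_; Dec; yes; no)
open import Relation.Nullary.Decidable using (_×-dec_; ¬?; _→-dec_)
open import Relation.Binary.PropositionalEquality using (_≡_)

-- Partially ordered patterns.
-- A POP of length k: a (decidable) strict partial order _<P_ on the
-- labels Fin k (label j+1 of the paper is  j : Fin k).

record POP (k : ℕ) : Set₁ where
  field
    _<P_      : Fin k → Fin k → Set
    _<P?_     : ∀ i j → Dec (i <P j)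
    irrefl    : ∀ i → ¬ (i <P i)
    trans     : ∀ {i j l} → i <P j → j <P l → i <P l

-- n-permutations in one-line notation: vectors π = π_1 ⋯ π_n with
-- entries in Fin n (value v+1 of the paper is  v : Fin n), all distinct.
IsPerm : ∀ {n} → Vec (Fin n) n → Set
IsPerm {n} π = ∀ (i j : Fin n) → lookup π i ≡ lookup π j → i ≡ j

Occurrence : ∀ {k n} → POP k → Vec (Fin n) n → Vec (Fin n) k → Set
Occurrence {k} p π ι =
  (∀ (j m : Fin k) → j Fin.< m → lookup ι j Fin.< lookup ι m) ×
  (∀ (j m : Fin k) → j <P m → lookup π (lookup ι j) Fin.< lookup π (lookup ι m))
  where open POP p

Contains : ∀ {k n} → POP k → Vec (Fin n) n → Set
Contains p π = ∃ λ ι → Occurrence p π ι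

Avoids : ∀ {k n} → POP k → Vec (Fin n) n → Set
Avoids p π = ¬ Contains p π

∃Vec? : ∀ {n} k (P : Vec (Fin n) k → Set) → (∀ v → Dec (P v)) → Dec (∃ P)
∃Vec? zero P P? with P? []
... | yes p = yes ([] , p)
... | no ¬p = no λ { ([] , p) → ¬p p }
∃Vec? (suc k) P P? with ∃Vec? k (λ v → ∃ λ i → P (i ∷ v)) (λ v → any? (λ i → P? (i ∷ v)))
... | yes (v , i , p) = yes (i ∷ v , p)
... | no ¬q = no λ { (i ∷ v , p) → ¬q (v , i , p) }

IsPerm? : ∀ {n} (π : Vec (Fin n) n) → Dec (IsPerm π)
IsPerm? π = all? λ i → all? λ j → (lookup π i ≟ lookup π j) →-dec (i ≟ j)

Occurrence? : ∀ {k n} (p : POP k) (π : Vec (Fin n) n) ι → Dec (Occurrence p π ι)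
Occurrence? p π ι =
  (all? λ j → all? λ m → (j Fin.<? m) →-dec (lookup ι j Fin.<? lookup ι m)) ×-dec
  (all? λ j → all? λ m → (j <P? m) →-dec (lookup π (lookup ι j) Fin.<? lookup π (lookup ι m)))
  where open POP p

Avoids? : ∀ {k n} (p : POP k) (π : Vec (Fin n) n) → Dec (Avoids p π)
Avoids? {k} p π = ¬? (∃Vec? k (Occurrence p π) (Occurrence? p π))

sumFin : ∀ m → (Fin m → ℕ) → ℕ
sumFin zero    f = 0
sumFin (suc m) f = f zero ℕ.+ sumFin m (λ i → f (suc i))

countVec : ∀ {n} k (P : Vec (Fin n) k → Set) → (∀ v → Dec (P v)) → ℕ
countVec zero P P? with P? []
... | yes _ = 1
... | no  _ = 0
countVec {n} (suc k) P P? =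
  sumFin n λ i → countVec k (λ v → P (i ∷ v)) (λ v → P? (i ∷ v))

numAvoiders : ∀ {k} → POP k → ℕ → ℕ
numAvoiders p n =
  countVec n (λ π → IsPerm π × Avoids p π) (λ π → IsPerm? π ×-dec Avoids? p π)

-- The POP of the theorem: labels 1,2,3,4 = zero, 1, 2, 3 : Fin 4;
-- relations 1 > 2 and 1 > 4, i.e.  2 <_P 1  and  4 <_P 1.

data _<p₁₈_ : Fin 4 → Fin 4 → Set where
  2<1 : suc zero <p₁₈ zero
  4<1 : suc (suc (suc zero)) <p₁₈ zero

p₁₈ : POP 4
p₁₈ = record
  { _<P_ = _<p₁₈_
  ; _<P?_ = dec
  ; irrefl = λ { _ () }
  ; trans = λ { 2<1 () ; 4<1 () }
  }
  where
  dec : ∀ i j → Dec (i <p₁₈ j)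
  dec (suc zero) zero = yes 2<1
  dec (suc (suc (suc zero))) zero = yes 4<1
  dec zero j = no λ ()
  dec (suc zero) (suc j) = no λ ()
  dec (suc (suc zero)) j = no λ ()
  dec (suc (suc (suc zero))) (suc j) = no λ ()

-- Formal power series with integer coefficients, as ℕ → ℤ.
-- A polynomial is a list of coefficients c₀ ∷ c₁ ∷ ⋯.

polyCoeff : List ℤ → ℕ → ℤ
polyCoeff []       n       = + 0
polyCoeff (c ∷ cs) zero    = c
polyCoeff (c ∷ cs) (suc n) = polyCoeff cs n

polyMul : List ℤ → (ℕ → ℤ) → ℕ → ℤ
polyMul []       f n       = + 0
polyMul (c ∷ cs) f zero    = c ℤ.* f zero
polyMul (c ∷ cs) f (suc n) = c ℤ.* f (suc n) ℤ.+ polyMul cs f n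

den₁₈ : List ℤ
den₁₈ = + 1 ∷ ℤ.- (+ 3) ∷ + 2 ∷ ℤ.- (+ 2) ∷ []

num₁₈ : List ℤ
num₁₈ = + 1 ∷ ℤ.- (+ 2) ∷ + 1 ∷ []

-- Write a permutation of length n + 1 as x ◂ τ: first entry x, the rest order-isomorphic to τ.
-- An occurrence of p₁₈ either misses the first position, and is then an occurrence in τ, or
-- starts at x, and then its second and fourth entries are two entries below x at distance
-- at least 2. So x ◂ τ avoids p₁₈ iff τ does and the entries of τ below x are pairwise
-- adjacent ("clustered"). For a permutation τ this holds automatically when x ≤ 1, never when
-- x ≥ 3, and for x = 2 it says that 0 and 1 are adjacent in τ. Counting by first entry the
-- avoiders (a), the avoiders with 0 and 1 adjacent (b) and the avoiders starting with 0 (c)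
-- gives a(n+3) = 2a(n+2) + b(n+2), b(n+3) = 2c(n+2) + b(n+2) and c(n+1) = a(n), hence
-- a(n+4) = 3a(n+3) - 2a(n+2) + 2a(n+1), which is the stated generating function.

module Submission where

open import Defs
open import Data.Fin.Base using (Fin; zero; suc; toℕ; inject₁; punchIn; punchOut)
import Data.Fin.Properties as Fin
open import Data.Integer.Base as ℤ using (+_)
import Data.Integer.Properties as ℤ
import Data.Integer.Tactic.RingSolver as ℤ
open import Data.Nat.Base using (ℕ; zero; suc; _+_; _*_; _≤_; _<_; z≤n; s≤s; s≤s⁻¹; s<s⁻¹)
import Data.Nat.Properties as ℕ
open import Data.Nat.Tactic.RingSolver using (solve-∀)
open import Data.Product.Base using (∃; ∃₂; _×_; _,_; proj₁)
open import Data.Sum.Base using (_⊎_; inj₁; inj₂; [_,_]′)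
open import Data.Vec.Base using (Vec; []; _∷_; lookup; map)
open import Data.Vec.Properties using (lookup-map)
open import Function.Base using (_∘_; id)
open import Function.Bundles using (_⇔_; mk⇔; Equivalence)
open import Function.Definitions using (Injective)
open import Relation.Binary.Definitions using (tri<; tri≈; tri>)
open import Relation.Binary.PropositionalEquality
open import Relation.Nullary using (¬_; Dec; yes; no; contradiction)
open import Relation.Nullary.Decidable using (_×-dec_; ¬?)

open import Algebra.Properties.CommutativeSemigroup ℕ.+-commutativeSemigroup using (x∙yz≈y∙xz)
open Equivalence using (to; from)
open ≡-Reasoning

sumFin-cong : ∀ m {f g : Fin m → ℕ} → (∀ i → f i ≡ g i) → sumFin m f ≡ sumFin m g
sumFin-cong zero    f≗g = refl
sumFin-cong (suc m) f≗g = cong₂ _+_ (f≗g zero) (sumFin-cong m (f≗g ∘ suc))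

sumFin-zero : ∀ m {f : Fin m → ℕ} → (∀ i → f i ≡ 0) → sumFin m f ≡ 0
sumFin-zero zero    f≗0 = refl
sumFin-zero (suc m) f≗0 = cong₂ _+_ (f≗0 zero) (sumFin-zero m (f≗0 ∘ suc))

sumFin-punchIn : ∀ m (x : Fin (suc m)) (f : Fin (suc m) → ℕ) →
                 sumFin (suc m) f ≡ f x + sumFin m (f ∘ punchIn x)
sumFin-punchIn m       zero    f = refl
sumFin-punchIn (suc m) (suc x) f = begin
  f zero + sumFin (suc m) (f ∘ suc)                   ≡⟨ cong (λ y → f zero + y) (sumFin-punchIn m x (f ∘ suc)) ⟩
  f zero + (f (suc x) + sumFin m (f ∘ suc ∘ punchIn x)) ≡⟨ x∙yz≈y∙xz (f zero) (f (suc x)) _ ⟩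
  f (suc x) + (f zero + sumFin m (f ∘ suc ∘ punchIn x)) ∎

countVec-cong : ∀ {n} k {P Q : Vec (Fin n) k → Set} (P? : ∀ v → Dec (P v)) (Q? : ∀ v → Dec (Q v)) →
                (∀ v → P v ⇔ Q v) → countVec k P P? ≡ countVec k Q Q?
countVec-cong zero P? Q? P⇔Q with P? [] | Q? []
... | yes _ | yes _ = refl
... | no  _ | no  _ = refl
... | yes p | no ¬q = contradiction (to (P⇔Q []) p) ¬q
... | no ¬p | yes q = contradiction (from (P⇔Q []) q) ¬p
countVec-cong (suc k) P? Q? P⇔Q = sumFin-cong _ λ i → countVec-cong k (P? ∘ (i ∷_)) (Q? ∘ (i ∷_)) (P⇔Q ∘ (i ∷_))

countVec-zero : ∀ {n} k {P : Vec (Fin n) k → Set} (P? : ∀ v → Dec (P v)) → (∀ v → ¬ P v) → countVec k P P? ≡ 0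
countVec-zero zero P? ¬P with P? []
... | yes p = contradiction p (¬P [])
... | no  _ = refl
countVec-zero (suc k) P? ¬P = sumFin-zero _ λ i → countVec-zero k (P? ∘ (i ∷_)) (¬P ∘ (i ∷_))

countVec-punchIn : ∀ {n} k (x : Fin (suc n)) {P : Vec (Fin (suc n)) k → Set} (P? : ∀ v → Dec (P v)) →
                   (∀ v → P v → ∀ i → lookup v i ≢ x) →
                   countVec k P P? ≡ countVec k (P ∘ map (punchIn x)) (P? ∘ map (punchIn x))
countVec-punchIn zero x P? _ with P? []
... | yes _ = refl
... | no  _ = refl
countVec-punchIn {n} (suc k) x {P} P? avoidsX = begin
  sumFin (suc n) count                 ≡⟨ sumFin-punchIn n x count ⟩
  count x + sumFin n (count ∘ punchIn x) ≡⟨ cong₂ _+_ (countVec-zero k (λ v → P? (x ∷ v)) λ v p → avoidsX (x ∷ v) p zero refl) refl ⟩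
  sumFin n (count ∘ punchIn x)           ≡⟨ sumFin-cong n (λ j → countVec-punchIn k x (λ v → P? (punchIn x j ∷ v)) λ v p i → avoidsX (punchIn x j ∷ v) p (suc i)) ⟩
  countVec (suc k) (P ∘ map (punchIn x)) (P? ∘ map (punchIn x)) ∎
  where
  count : Fin (suc n) → ℕ
  count i = countVec k (λ v → P (i ∷ v)) (λ v → P? (i ∷ v))

toℕ-punchIn-< : ∀ {n} (x : Fin (suc n)) v → toℕ v < toℕ x → toℕ (punchIn x v) ≡ toℕ v
toℕ-punchIn-< zero    v       ()
toℕ-punchIn-< (suc x) zero    _         = refl
toℕ-punchIn-< (suc x) (suc v) (s≤s v<x) = cong suc (toℕ-punchIn-< x v v<x)

toℕ≤toℕ-punchIn : ∀ {n} (x : Fin (suc n)) v → toℕ v ≤ toℕ (punchIn x v)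
toℕ≤toℕ-punchIn zero    v       = ℕ.n≤1+n (toℕ v)
toℕ≤toℕ-punchIn (suc x) zero    = z≤n
toℕ≤toℕ-punchIn (suc x) (suc v) = s≤s (toℕ≤toℕ-punchIn x v)

punchIn-<-below : ∀ {n} (x : Fin (suc n)) v {t} → t ≤ toℕ x → toℕ (punchIn x v) < t ⇔ toℕ v < t
punchIn-<-below x v t≤x = mk⇔
  (ℕ.≤-<-trans (toℕ≤toℕ-punchIn x v))
  (λ v<t → subst (_< _) (sym (toℕ-punchIn-< x v (ℕ.<-≤-trans v<t t≤x))) v<t)

punchIn-mono-< : ∀ {n} (x : Fin (suc n)) {j k} → toℕ j < toℕ k → toℕ (punchIn x j) < toℕ (punchIn x k)
punchIn-mono-< x j<k =
  Fin.≤∧≢⇒< (Fin.punchIn-mono-≤ x _ _ (ℕ.<⇒≤ j<k)) (Fin.<⇒≢ j<k ∘ Fin.punchIn-injective x _ _)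

punchIn-cancel-< : ∀ {n} (x : Fin (suc n)) {j k} → toℕ (punchIn x j) < toℕ (punchIn x k) → toℕ j < toℕ k
punchIn-cancel-< x πⱼ<πₖ =
  Fin.≤∧≢⇒< (Fin.punchIn-cancel-≤ x _ _ (ℕ.<⇒≤ πⱼ<πₖ)) (Fin.<⇒≢ πⱼ<πₖ ∘ cong (punchIn x))

infixr 5 _◂_
_◂_ : ∀ {n k} → Fin (suc n) → Vec (Fin n) k → Vec (Fin (suc n)) (suc k)
x ◂ τ = x ∷ map (punchIn x) τ

lookup-◂ : ∀ {n k} (x : Fin (suc n)) (τ : Vec (Fin n) k) i →
           lookup (x ◂ τ) (suc i) ≡ punchIn x (lookup τ i)
lookup-◂ x τ i = lookup-map i (punchIn x) τ

IsPerm-◂ : ∀ {n} x (τ : Vec (Fin n) n) → IsPerm (x ◂ τ) ⇔ IsPerm τ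
IsPerm-◂ x τ = mk⇔ tail-injective cons-injective
  where
  tail-injective : IsPerm (x ◂ τ) → IsPerm τ
  tail-injective inj i j τᵢ≡τⱼ = Fin.suc-injective (inj (suc i) (suc j)
    (trans (lookup-◂ x τ i) (trans (cong (punchIn x) τᵢ≡τⱼ) (sym (lookup-◂ x τ j)))))

  cons-injective : IsPerm τ → IsPerm (x ◂ τ)
  cons-injective inj zero    zero    _ = refl
  cons-injective inj zero    (suc j) e = contradiction (sym (trans e (lookup-◂ x τ j))) (Fin.punchInᵢ≢i x _)
  cons-injective inj (suc i) zero    e = contradiction (trans (sym (lookup-◂ x τ i)) e) (Fin.punchInᵢ≢i x _)
  cons-injective inj (suc i) (suc j) e = cong suc (inj i j (Fin.punchIn-injective x _ _
    (trans (sym (lookup-◂ x τ i)) (trans e (lookup-◂ x τ j)))))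

IsPerm⇒surjective : ∀ {n} (π : Vec (Fin n) n) → IsPerm π → ∀ v → ∃ λ i → lookup π i ≡ v
IsPerm⇒surjective {suc n} π inj v with Fin.any? (λ i → lookup π i Fin.≟ v)
... | yes hit  = hit
... | no  miss = contradiction (Fin.injective⇒≤ squeeze-injective) ℕ.1+n≰n
  where
  v∉π : ∀ i → v ≢ lookup π i
  v∉π i v≡πᵢ = miss (i , sym v≡πᵢ)

  squeeze : Fin (suc n) → Fin n
  squeeze i = punchOut (v∉π i)

  squeeze-injective : Injective _≡_ _≡_ squeeze
  squeeze-injective {i} {j} eq = inj i j (Fin.punchOut-injective (v∉π i) (v∉π j) eq)

below-◂ : ∀ {n k} (x : Fin (suc n)) (τ : Vec (Fin n) k) {t} i → t ≤ toℕ x →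
          toℕ (lookup (x ◂ τ) (suc i)) < t ⇔ toℕ (lookup τ i) < t
below-◂ x τ i t≤x = subst (λ y → toℕ y < _ ⇔ _) (sym (lookup-◂ x τ i)) (punchIn-<-below x _ t≤x)

Occurrence-◂ : ∀ {k n} (p : POP k) x (τ : Vec (Fin n) n) ι →
               Occurrence p (x ◂ τ) (map suc ι) ⇔ Occurrence p τ ι
Occurrence-◂ p x τ ι = mk⇔
  (λ (increasing , respects) →
     (λ j m j<m → s<s⁻¹ (subst₂ _<ᶠ_ (position j) (position m) (increasing j m j<m))) ,
     (λ j m j<m → punchIn-cancel-< x (subst₂ _<ᶠ_ (entry j) (entry m) (respects j m j<m))))
  (λ (increasing , respects) →
     (λ j m j<m → subst₂ _<ᶠ_ (sym (position j)) (sym (position m)) (s≤s (increasing j m j<m))) ,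
     (λ j m j<m → subst₂ _<ᶠ_ (sym (entry j)) (sym (entry m)) (punchIn-mono-< x (respects j m j<m))))
  where
  _<ᶠ_ : ∀ {m} → Fin m → Fin m → Set
  u <ᶠ w = toℕ u < toℕ w

  position : ∀ j → lookup (map suc ι) j ≡ suc (lookup ι j)
  position j = lookup-map j suc ι

  entry : ∀ j → lookup (x ◂ τ) (lookup (map suc ι) j) ≡ punchIn x (lookup τ (lookup ι j))
  entry j = trans (cong (lookup (x ◂ τ)) (position j)) (lookup-◂ x τ (lookup ι j))

FarPairBelow : ∀ {m k} → ℕ → Vec (Fin m) k → Set
FarPairBelow t σ = ∃₂ λ j l → 2 + toℕ j ≤ toℕ l × toℕ (lookup σ j) < t × toℕ (lookup σ l) < t

farPairBelow? : ∀ {m k} t (σ : Vec (Fin m) k) → Dec (FarPairBelow t σ)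
farPairBelow? t σ = Fin.any? λ j → Fin.any? λ l →
  2 + toℕ j ℕ.≤? toℕ l ×-dec toℕ (lookup σ j) ℕ.<? t ×-dec toℕ (lookup σ l) ℕ.<? t

Clustered : ∀ {m k} → ℕ → Vec (Fin m) k → Set
Clustered t σ = ¬ FarPairBelow t σ

increasing₄ : ∀ {m} {a b c d : Fin m} → toℕ a < toℕ b → toℕ b < toℕ c → toℕ c < toℕ d →
              ∀ (j l : Fin 4) → toℕ j < toℕ l →
              toℕ (lookup (a ∷ b ∷ c ∷ d ∷ []) j) < toℕ (lookup (a ∷ b ∷ c ∷ d ∷ []) l)
increasing₄ a<b b<c c<d = λ where
  zero                   (suc zero)             _ → a<b
  zero                   (suc (suc zero))       _ → ℕ.<-trans a<b b<c
  zero                   (suc (suc (suc zero))) _ → ℕ.<-trans a<b (ℕ.<-trans b<c c<d)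
  (suc zero)             (suc (suc zero))       _ → b<c
  (suc zero)             (suc (suc (suc zero))) _ → ℕ.<-trans b<c c<d
  (suc (suc zero))       (suc (suc (suc zero))) _ → c<d
  zero                   zero                   ()
  (suc zero)             zero                   ()
  (suc zero)             (suc zero)             (s≤s ())
  (suc (suc zero))       zero                   ()
  (suc (suc zero))       (suc zero)             (s≤s ())
  (suc (suc zero))       (suc (suc zero))       (s≤s (s≤s ()))
  (suc (suc (suc zero))) zero                   ()
  (suc (suc (suc zero))) (suc zero)             (s≤s ())
  (suc (suc (suc zero))) (suc (suc zero))       (s≤s (s≤s ()))
  (suc (suc (suc zero))) (suc (suc (suc zero))) (s≤s (s≤s (s≤s ())))

two-apart : ∀ {x y z} → x < y → y < z → 2 + x ≤ z
two-apart x<y y<z = ℕ.≤-trans (s≤s x<y) y<z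

Contains-◂ : ∀ {n} x (τ : Vec (Fin n) n) →
             Contains p₁₈ (x ◂ τ) ⇔ (Contains p₁₈ τ ⊎ FarPairBelow (toℕ x) τ)
Contains-◂ x τ = mk⇔ split merge
  where
  split : Contains p₁₈ (x ◂ τ) → Contains p₁₈ τ ⊎ FarPairBelow (toℕ x) τ
  split (_ ∷ zero ∷ _ ∷ _ ∷ [] , increasing , _) =
    contradiction (increasing zero (suc zero) (s≤s z≤n)) ℕ.n≮0
  split (_ ∷ suc _ ∷ zero ∷ _ ∷ [] , increasing , _) =
    contradiction (increasing (suc zero) (suc (suc zero)) (s≤s (s≤s z≤n))) ℕ.n≮0
  split (_ ∷ suc _ ∷ suc _ ∷ zero ∷ [] , increasing , _) =
    contradiction (increasing (suc (suc zero)) (suc (suc (suc zero))) (s≤s (s≤s (s≤s z≤n)))) ℕ.n≮0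
  split (zero ∷ suc j ∷ suc m ∷ suc l ∷ [] , increasing , respects) = inj₂
    (j , l ,
     two-apart (s<s⁻¹ (increasing (suc zero) (suc (suc zero)) (s≤s (s≤s z≤n))))
               (s<s⁻¹ (increasing (suc (suc zero)) (suc (suc (suc zero))) (s≤s (s≤s (s≤s z≤n))))) ,
     to (below-◂ x τ j ℕ.≤-refl) (respects (suc zero) zero 2<1) ,
     to (below-◂ x τ l ℕ.≤-refl) (respects (suc (suc (suc zero))) zero 4<1))
  split (suc i₀ ∷ suc i₁ ∷ suc i₂ ∷ suc i₃ ∷ [] , occurrence) =
    inj₁ (i₀ ∷ i₁ ∷ i₂ ∷ i₃ ∷ [] , to (Occurrence-◂ p₁₈ x τ (i₀ ∷ i₁ ∷ i₂ ∷ i₃ ∷ [])) occurrence)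

  merge : Contains p₁₈ τ ⊎ FarPairBelow (toℕ x) τ → Contains p₁₈ (x ◂ τ)
  merge (inj₁ (ι , occurrence)) = map suc ι , from (Occurrence-◂ p₁₈ x τ ι) occurrence
  merge (inj₂ (j , l , j+2≤l , τⱼ<x , τₗ<x)) =
    zero ∷ suc j ∷ inject₁ l ∷ suc l ∷ [] ,
    increasing₄ (s≤s z≤n) (subst (2 + toℕ j ≤_) (sym (Fin.toℕ-inject₁ l)) j+2≤l) (Fin.≤̄⇒inject₁< ℕ.≤-refl) ,
    λ { _ _ 2<1 → from (below-◂ x τ j ℕ.≤-refl) τⱼ<x
      ; _ _ 4<1 → from (below-◂ x τ l ℕ.≤-refl) τₗ<x }

Avoider : ∀ {n} → Vec (Fin n) n → Set
Avoider π = IsPerm π × Avoids p₁₈ π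

Avoider? : ∀ {n} (π : Vec (Fin n) n) → Dec (Avoider π)
Avoider? π = IsPerm? π ×-dec Avoids? p₁₈ π

Avoider-◂ : ∀ {n} x (τ : Vec (Fin n) n) → Avoider (x ◂ τ) ⇔ (Avoider τ × Clustered (toℕ x) τ)
Avoider-◂ x τ = mk⇔
  (λ (perm , avoids) → (to (IsPerm-◂ x τ) perm , avoids ∘ from (Contains-◂ x τ) ∘ inj₁) ,
                       avoids ∘ from (Contains-◂ x τ) ∘ inj₂)
  (λ ((perm , avoids) , clustered) → from (IsPerm-◂ x τ) perm , [ avoids , clustered ]′ ∘ to (Contains-◂ x τ))

Clustered-≤1 : ∀ {n t} (τ : Vec (Fin n) n) → t ≤ 1 → IsPerm τ → Clustered t τ
Clustered-≤1 τ t≤1 inj (j , l , j+2≤l , τⱼ<t , τₗ<t) =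
  ℕ.1+n≰n (ℕ.m+n≤o⇒n≤o 1 (subst (λ i → 2 + toℕ j ≤ toℕ i) (sym j≡l) j+2≤l))
  where
  isZero : ∀ {y} → y < _ → y ≡ 0
  isZero y<t = ℕ.n<1⇒n≡0 (ℕ.<-≤-trans y<t t≤1)

  j≡l : j ≡ l
  j≡l = inj j l (Fin.toℕ-injective (trans (isZero τⱼ<t) (sym (isZero τₗ<t))))

Apart : ℕ → ℕ → Set
Apart x y = 2 + x ≤ y ⊎ 2 + y ≤ x

distinct⇒apart : ∀ {x y z} → x ≢ y → y ≢ z → x ≢ z → Apart x y ⊎ Apart y z ⊎ Apart x z
distinct⇒apart {x} {y} {z} x≢y y≢z x≢z with ℕ.<-cmp x y | ℕ.<-cmp y z | ℕ.<-cmp x z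
... | tri≈ _ x≡y _ | _            | _            = contradiction x≡y x≢y
... | _            | tri≈ _ y≡z _ | _            = contradiction y≡z y≢z
... | _            | _            | tri≈ _ x≡z _ = contradiction x≡z x≢z
... | tri< x<y _ _ | tri< y<z _ _ | _            = inj₂ (inj₂ (inj₁ (two-apart x<y y<z)))
... | tri< _ _ _   | tri> _ _ z<y | tri< x<z _ _ = inj₁ (inj₁ (two-apart x<z z<y))
... | tri< x<y _ _ | tri> _ _ _   | tri> _ _ z<x = inj₂ (inj₁ (inj₂ (two-apart z<x x<y)))
... | tri> _ _ y<x | tri< _ _ _   | tri< x<z _ _ = inj₂ (inj₁ (inj₁ (two-apart y<x x<z)))
... | tri> _ _ _   | tri< y<z _ _ | tri> _ _ z<x = inj₁ (inj₂ (two-apart y<z z<x))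
... | tri> _ _ y<x | tri> _ _ z<y | _            = inj₂ (inj₂ (inj₂ (two-apart z<y y<x)))

-- The entries 0, 1, 2 sit at three distinct positions, two of which are apart.
Clustered-≥3 : ∀ {n t} (τ : Vec (Fin (3 + n)) (3 + n)) → 3 ≤ t → IsPerm τ → ¬ Clustered t τ
Clustered-≥3 {t = t} τ 3≤t inj clustered =
  let i₀ , τᵢ₀≡0 = IsPerm⇒surjective τ inj zero
      i₁ , τᵢ₁≡1 = IsPerm⇒surjective τ inj (suc zero)
      i₂ , τᵢ₂≡2 = IsPerm⇒surjective τ inj (suc (suc zero))
      b₀ = below τᵢ₀≡0 (s≤s z≤n)
      b₁ = below τᵢ₁≡1 (s≤s (s≤s z≤n))
      b₂ = below τᵢ₂≡2 (s≤s (s≤s (s≤s z≤n)))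
  in [ notApart b₀ b₁ , [ notApart b₁ b₂ , notApart b₀ b₂ ]′ ]′
       (distinct⇒apart (distinct τᵢ₀≡0 τᵢ₁≡1 λ ()) (distinct τᵢ₁≡1 τᵢ₂≡2 λ ()) (distinct τᵢ₀≡0 τᵢ₂≡2 λ ()))
  where
  below : ∀ {i v} → lookup τ i ≡ v → toℕ v < 3 → toℕ (lookup τ i) < t
  below refl v<3 = ℕ.<-≤-trans v<3 3≤t

  distinct : ∀ {i j u w} → lookup τ i ≡ u → lookup τ j ≡ w → u ≢ w → toℕ i ≢ toℕ j
  distinct τᵢ≡u τⱼ≡w u≢w i≡j =
    u≢w (trans (sym τᵢ≡u) (trans (cong (lookup τ) (Fin.toℕ-injective i≡j)) τⱼ≡w))

  notApart : ∀ {i j} → toℕ (lookup τ i) < t → toℕ (lookup τ j) < t → ¬ Apart (toℕ i) (toℕ j)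
  notApart τᵢ<t τⱼ<t (inj₁ i+2≤j) = clustered (_ , _ , i+2≤j , τᵢ<t , τⱼ<t)
  notApart τᵢ<t τⱼ<t (inj₂ j+2≤i) = clustered (_ , _ , j+2≤i , τⱼ<t , τᵢ<t)

Clustered-◂ : ∀ {n k} (x : Fin (suc n)) (τ : Vec (Fin n) k) {t} → t ≤ toℕ x →
              Clustered t (x ◂ τ) ⇔ Clustered t τ
Clustered-◂ x τ t≤x = mk⇔ (λ clustered → clustered ∘ shift) (λ clustered → clustered ∘ unshift)
  where
  shift : FarPairBelow _ τ → FarPairBelow _ (x ◂ τ)
  shift (j , l , j+2≤l , τⱼ<t , τₗ<t) =
    suc j , suc l , s≤s j+2≤l , from (below-◂ x τ j t≤x) τⱼ<t , from (below-◂ x τ l t≤x) τₗ<t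

  unshift : FarPairBelow _ (x ◂ τ) → FarPairBelow _ τ
  unshift (zero  , _     , _      , x<t , _) = contradiction x<t (ℕ.≤⇒≯ t≤x)
  unshift (suc j , suc l , j+3≤l+1 , πⱼ<t , πₗ<t) =
    j , l , s≤s⁻¹ j+3≤l+1 , to (below-◂ x τ j t≤x) πⱼ<t , to (below-◂ x τ l t≤x) πₗ<t

data StartsWithZero : ∀ {n k} → Vec (Fin n) k → Set where
  zero∷ : ∀ {n k} (σ : Vec (Fin (suc n)) k) → StartsWithZero (zero ∷ σ)

startsWithZero? : ∀ {n k} (σ : Vec (Fin n) k) → Dec (StartsWithZero σ)
startsWithZero? []          = no λ ()
startsWithZero? (zero ∷ σ)  = yes (zero∷ σ)
startsWithZero? (suc _ ∷ _) = no λ ()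

punchIn-<2⇒≡0 : ∀ {n} (x : Fin (2 + n)) {v} → toℕ x < 2 → toℕ (punchIn x v) < 2 → v ≡ zero
punchIn-<2⇒≡0 zero             {zero}  _ _                = refl
punchIn-<2⇒≡0 zero             {suc v} _ (s≤s (s≤s ()))
punchIn-<2⇒≡0 (suc zero)       {zero}  _ _                = refl
punchIn-<2⇒≡0 (suc zero)       {suc v} _ (s≤s (s≤s ()))
punchIn-<2⇒≡0 (suc (suc _))            (s≤s (s≤s ())) _

punchIn-<2-zero : ∀ {n} (x : Fin (2 + n)) → toℕ x < 2 → toℕ (punchIn x zero) < 2
punchIn-<2-zero zero          _ = s≤s (s≤s z≤n)
punchIn-<2-zero (suc zero)    _ = s≤s z≤n
punchIn-<2-zero (suc (suc _)) (s≤s (s≤s ()))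

-- With x ∈ {0, 1} in front, the other of 0, 1 must come right after it.
Clustered-◂⇒StartsWithZero : ∀ {n} (x : Fin (2 + n)) (τ : Vec (Fin (suc n)) (suc n)) →
                             toℕ x < 2 → IsPerm τ → Clustered 2 (x ◂ τ) → StartsWithZero τ
Clustered-◂⇒StartsWithZero x (v ∷ σ) x<2 inj clustered with IsPerm⇒surjective (v ∷ σ) inj zero
... | zero  , refl = zero∷ σ
... | suc i , σᵢ≡0 = contradiction
  (zero , suc (suc i) , s≤s (s≤s z≤n) , x<2 ,
   subst (λ y → toℕ y < 2) (sym (trans (lookup-◂ x (v ∷ σ) (suc i)) (cong (punchIn x) σᵢ≡0))) (punchIn-<2-zero x x<2))
  clustered

StartsWithZero⇒Clustered-◂ : ∀ {n} (x : Fin (2 + n)) (τ : Vec (Fin (suc n)) (suc n)) →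
                             toℕ x < 2 → IsPerm τ → StartsWithZero τ → Clustered 2 (x ◂ τ)
StartsWithZero⇒Clustered-◂ x (zero ∷ σ) x<2 inj (zero∷ σ) (_ , suc zero , s≤s () , _)
StartsWithZero⇒Clustered-◂ x (zero ∷ σ) x<2 inj (zero∷ σ) (_ , suc (suc l) , _ , _ , πₗ<2) =
  Fin.0≢1+n (sym (inj (suc l) zero (punchIn-<2⇒≡0 x x<2 (subst (λ y → toℕ y < 2) (lookup-◂ x (zero ∷ σ) (suc l)) πₗ<2))))

ClusteredAvoider : ∀ {n} → Vec (Fin n) n → Set
ClusteredAvoider π = Avoider π × Clustered 2 π

ClusteredAvoider? : ∀ {n} (π : Vec (Fin n) n) → Dec (ClusteredAvoider π)
ClusteredAvoider? π = Avoider? π ×-dec ¬? (farPairBelow? 2 π)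

ZeroFirstAvoider : ∀ {n} → Vec (Fin n) n → Set
ZeroFirstAvoider π = Avoider π × StartsWithZero π

ZeroFirstAvoider? : ∀ {n} (π : Vec (Fin n) n) → Dec (ZeroFirstAvoider π)
ZeroFirstAvoider? π = Avoider? π ×-dec startsWithZero? π

a b c : ℕ → ℕ
a n = countVec n Avoider Avoider?
b n = countVec n ClusteredAvoider ClusteredAvoider?
c n = countVec n ZeroFirstAvoider ZeroFirstAvoider?

headed : ∀ n {Q : Vec (Fin (suc n)) (suc n) → Set} → (∀ π → Dec (Q π)) → Fin (suc n) → ℕ
headed n {Q} Q? x = countVec n (Q ∘ (x ◂_)) (Q? ∘ (x ◂_))

countPerms-byHead : ∀ n {Q : Vec (Fin (suc n)) (suc n) → Set} (Q? : ∀ π → Dec (Q π)) →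
                    (∀ π → Q π → IsPerm π) → countVec (suc n) Q Q? ≡ sumFin (suc n) (headed n Q?)
countPerms-byHead n Q? isPerm = sumFin-cong (suc n) λ x →
  countVec-punchIn n x (λ v → Q? (x ∷ v)) λ v q i vᵢ≡x → Fin.0≢1+n (isPerm (x ∷ v) q zero (suc i) (sym vᵢ≡x))

headed-Avoider-≤1 : ∀ n (x : Fin (suc n)) → toℕ x ≤ 1 → headed n Avoider? x ≡ a n
headed-Avoider-≤1 n x x≤1 = countVec-cong n (Avoider? ∘ (x ◂_)) Avoider? λ τ → mk⇔
  (proj₁ ∘ to (Avoider-◂ x τ))
  (λ avoider → from (Avoider-◂ x τ) (avoider , Clustered-≤1 τ x≤1 (proj₁ avoider)))

headed-≥3 : ∀ {m} (i : Fin m) {Q : Vec (Fin (3 + m)) (3 + m) → Set} (Q? : ∀ π → Dec (Q π)) →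
            (∀ π → Q π → Avoider π) → headed (2 + m) Q? (suc (suc (suc i))) ≡ 0
headed-≥3 {suc m} i Q? avoider = countVec-zero (3 + m) (Q? ∘ (suc (suc (suc i)) ◂_)) λ τ q →
  let (inj , _) , clustered = to (Avoider-◂ (suc (suc (suc i))) τ) (avoider (suc (suc (suc i)) ◂ τ) q)
  in Clustered-≥3 τ (s≤s (s≤s (s≤s z≤n))) inj clustered

headed-ClusteredAvoider-<2 : ∀ n (x : Fin (2 + n)) → toℕ x < 2 → headed (suc n) ClusteredAvoider? x ≡ c (suc n)
headed-ClusteredAvoider-<2 n x x<2 = countVec-cong (suc n) (ClusteredAvoider? ∘ (x ◂_)) ZeroFirstAvoider? λ τ → mk⇔
    (λ (avoider , clustered) → let avoiderτ , _ = to (Avoider-◂ x τ) avoider in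
       avoiderτ , Clustered-◂⇒StartsWithZero x τ x<2 (proj₁ avoiderτ) clustered)
    (λ (avoiderτ , startsWithZero) →
       from (Avoider-◂ x τ) (avoiderτ , Clustered-≤1 τ (s≤s⁻¹ x<2) (proj₁ avoiderτ)) ,
       StartsWithZero⇒Clustered-◂ x τ x<2 (proj₁ avoiderτ) startsWithZero)

headed-Avoider-2 : ∀ n (x : Fin (suc n)) → toℕ x ≡ 2 → headed n Avoider? x ≡ b n
headed-Avoider-2 n x x≡2 = countVec-cong n (Avoider? ∘ (x ◂_)) ClusteredAvoider? λ τ →
  subst (λ t → Avoider (x ◂ τ) ⇔ (Avoider τ × Clustered t τ)) x≡2 (Avoider-◂ x τ)

headed-ClusteredAvoider-2 : ∀ n (x : Fin (suc n)) → toℕ x ≡ 2 → headed n ClusteredAvoider? x ≡ b n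
headed-ClusteredAvoider-2 n x x≡2 = countVec-cong n (ClusteredAvoider? ∘ (x ◂_)) ClusteredAvoider? λ τ → mk⇔
  (λ (avoider , _) → let avoiderτ , clustered = to (Avoider-◂ x τ) avoider in
     avoiderτ , subst (λ t → Clustered t τ) x≡2 clustered)
  (λ (avoiderτ , clustered) →
     from (Avoider-◂ x τ) (avoiderτ , subst (λ t → Clustered t τ) (sym x≡2) clustered) ,
     from (Clustered-◂ x τ (ℕ.≤-reflexive (sym x≡2))) clustered)

a-byHead : ∀ n → a (suc n) ≡ sumFin (suc n) (headed n Avoider?)
a-byHead n = countPerms-byHead n Avoider? λ _ → proj₁

b-byHead : ∀ n → b (suc n) ≡ sumFin (suc n) (headed n ClusteredAvoider?)
b-byHead n = countPerms-byHead n ClusteredAvoider? λ _ → proj₁ ∘ proj₁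

x+[x+[y+0]]≡2*x+y : ∀ x y → x + (x + (y + 0)) ≡ 2 * x + y
x+[x+[y+0]]≡2*x+y = solve-∀

a-step : ∀ m → a (3 + m) ≡ 2 * a (2 + m) + b (2 + m)
a-step m = begin
  a (3 + m)                                  ≡⟨ a-byHead (2 + m) ⟩
  sumFin (3 + m) (headed (2 + m) Avoider?)   ≡⟨ cong₂ _+_ (headed-Avoider-≤1 (2 + m) zero z≤n)
                                                 (cong₂ _+_ (headed-Avoider-≤1 (2 + m) (suc zero) (s≤s z≤n))
                                                 (cong₂ _+_ (headed-Avoider-2 (2 + m) (suc (suc zero)) refl)
                                                            (sumFin-zero m λ i → headed-≥3 i Avoider? λ _ → id))) ⟩
  a (2 + m) + (a (2 + m) + (b (2 + m) + 0))  ≡⟨ x+[x+[y+0]]≡2*x+y (a (2 + m)) (b (2 + m)) ⟩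
  2 * a (2 + m) + b (2 + m)                  ∎

b-step : ∀ m → b (3 + m) ≡ 2 * c (2 + m) + b (2 + m)
b-step m = begin
  b (3 + m)                                           ≡⟨ b-byHead (2 + m) ⟩
  sumFin (3 + m) (headed (2 + m) ClusteredAvoider?)   ≡⟨ cong₂ _+_ (headed-ClusteredAvoider-<2 (suc m) zero (s≤s z≤n))
                                                          (cong₂ _+_ (headed-ClusteredAvoider-<2 (suc m) (suc zero) (s≤s (s≤s z≤n)))
                                                          (cong₂ _+_ (headed-ClusteredAvoider-2 (2 + m) (suc (suc zero)) refl)
                                                                     (sumFin-zero m λ i → headed-≥3 i ClusteredAvoider? λ _ → proj₁))) ⟩
  c (2 + m) + (c (2 + m) + (b (2 + m) + 0))           ≡⟨ x+[x+[y+0]]≡2*x+y (c (2 + m)) (b (2 + m)) ⟩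
  2 * c (2 + m) + b (2 + m)                           ∎

c-step : ∀ n → c (suc n) ≡ a n
c-step n = begin
  c (suc n)                                  ≡⟨ countPerms-byHead n ZeroFirstAvoider? (λ _ → proj₁ ∘ proj₁) ⟩
  sumFin (suc n) (headed n ZeroFirstAvoider?) ≡⟨ cong₂ _+_ headed-0 (sumFin-zero n headed-suc) ⟩
  a n + 0                                    ≡⟨ ℕ.+-identityʳ (a n) ⟩
  a n                                        ∎
  where
  headed-0 : headed n ZeroFirstAvoider? zero ≡ a n
  headed-0 = trans (countVec-cong n (ZeroFirstAvoider? ∘ (zero ◂_)) (Avoider? ∘ (zero ◂_)) λ τ → mk⇔ proj₁ (_, zero∷ _))
                   (headed-Avoider-≤1 n zero z≤n)

  headed-suc : ∀ y → headed n ZeroFirstAvoider? (suc y) ≡ 0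
  headed-suc y = countVec-zero n (ZeroFirstAvoider? ∘ (suc y ◂_)) λ { _ (_ , ()) }

linear-recurrence : (u v w : ℕ → ℕ) →
                    (∀ m → u (3 + m) ≡ 2 * u (2 + m) + v (2 + m)) →
                    (∀ m → v (3 + m) ≡ 2 * w (2 + m) + v (2 + m)) →
                    (∀ n → w (suc n) ≡ u n) →
                    ∀ k → u (4 + k) + 2 * u (2 + k) ≡ 3 * u (3 + k) + 2 * u (1 + k)
linear-recurrence u v w u-step v-step w-step k
  rewrite u-step (suc k) | v-step k | w-step (suc k) | u-step k = identity (u (1 + k)) (u (2 + k)) (v (2 + k))
  where
  identity : ∀ x₁ x₂ y₂ → 2 * (2 * x₂ + y₂) + (2 * x₁ + y₂) + 2 * x₂ ≡ 3 * (2 * x₂ + y₂) + 2 * x₁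
  identity = solve-∀

den₁₈-annihilates : ∀ (u : ℕ → ℕ) k → u (4 + k) + 2 * u (2 + k) ≡ 3 * u (3 + k) + 2 * u (1 + k) →
                    polyMul den₁₈ (λ n → + u n) (4 + k) ≡ + 0
den₁₈-annihilates u k recurrence = begin
  polyMul den₁₈ (λ n → + u n) (4 + k)
    ≡⟨ regroup (+ u₄) (+ u₃) (+ u₂) (+ u₁) ⟩
  (+ u₄ ℤ.+ + 2 ℤ.* + u₂) ℤ.- (+ 3 ℤ.* + u₃ ℤ.+ + 2 ℤ.* + u₁)
    ≡⟨ cong₂ ℤ._-_ (sym lhs-embedding) (sym rhs-embedding) ⟩
  + (u₄ + 2 * u₂) ℤ.- + (3 * u₃ + 2 * u₁)
    ≡⟨ cong (λ s → + s ℤ.- + (3 * u₃ + 2 * u₁)) recurrence ⟩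
  + (3 * u₃ + 2 * u₁) ℤ.- + (3 * u₃ + 2 * u₁)
    ≡⟨ ℤ.+-inverseʳ (+ (3 * u₃ + 2 * u₁)) ⟩
  + 0 ∎
  where
  regroup : ∀ x₄ x₃ x₂ x₁ →
            + 1 ℤ.* x₄ ℤ.+ (ℤ.- + 3 ℤ.* x₃ ℤ.+ (+ 2 ℤ.* x₂ ℤ.+ (ℤ.- + 2 ℤ.* x₁ ℤ.+ + 0))) ≡
            (x₄ ℤ.+ + 2 ℤ.* x₂) ℤ.- (+ 3 ℤ.* x₃ ℤ.+ + 2 ℤ.* x₁)
  regroup = ℤ.solve-∀

  u₁ u₂ u₃ u₄ : ℕ
  u₁ = u (1 + k)
  u₂ = u (2 + k)
  u₃ = u (3 + k)
  u₄ = u (4 + k)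

  lhs-embedding : + (u₄ + 2 * u₂) ≡ + u₄ ℤ.+ + 2 ℤ.* + u₂
  lhs-embedding = trans (ℤ.pos-+ u₄ (2 * u₂)) (cong (λ z → + u₄ ℤ.+ z) (ℤ.pos-* 2 u₂))

  rhs-embedding : + (3 * u₃ + 2 * u₁) ≡ + 3 ℤ.* + u₃ ℤ.+ + 2 ℤ.* + u₁
  rhs-embedding = trans (ℤ.pos-+ (3 * u₃) (2 * u₁)) (cong₂ ℤ._+_ (ℤ.pos-* 3 u₃) (ℤ.pos-* 2 u₁))

theorem18 : ∀ n → polyMul den₁₈ (λ m → + numAvoiders p₁₈ m) n ≡ polyCoeff num₁₈ n
theorem18 0 = refl
theorem18 1 = refl
theorem18 2 = refl
theorem18 3 = refl
theorem18 (suc (suc (suc (suc k)))) = den₁₈-annihilates a k (linear-recurrence a b c a-step b-step c-step k)
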